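{- Let $G$ be a tree-path intersection graph with the rooting and orders described in the context. Let $h_1,h_2\in G_H$ and $v_1,v_2\in G_V$ with $h_1\le_\ell h_2$ and $v_1\le_\ell v_2$. If $h_1,h_2\in\Gamma(v_2)$ and $h_2\in\Gamma(v_1)$, then $h_1\in\Gamma(v_1)$.
   Context: A tree-path intersection graph is a connected bipartite graph $G$ with disjoint parts $G_H$, $G_V$, together with a tree $T_H$ on vertex set $G_H$ and a tree $T_V$ on vertex set $G_V$, such that for every $h\in G_H$ the neighbourhood $\Gamma(h)$ of $h$ in $G$ is the vertex set of a path in $T_V$, and for every $v\in G_V$ the neighbourhood $\Gamma(v)$ is the vertex set of a path in $T_H$. Fix an edge $h_{\mathrm{root}}v_{\mathrm{root}}\in E(G)$ such that $v_{\mathrm{root}}$ is a leaf of $T_V$; root $T_H$ at $h_{\mathrm{root}}$ and $T_V$ at $v_{\mathrm{root}}$. For $s_1,s_2$ both in $G_H$ (resp. both in $G_V$), $s_1\le s_2$ iff $s_1$ lies on the path of $T_H$ (resp. $T_V$) from the root to $s_2$; vertices from different sides are incomparable; $<$ is the strict version. $\min\Gamma(s)$ denotes the unique $\le$-minimal element of $\Gamma(s)$. Define $<_b$: for $s_1,s_2$ on the same side, $s_1<_b s_2$ iff $\min\Gamma(s_1)<\min\Gamma(s_2)$, or $\min\Gamma(s_1)=\min\Gamma(s_2)$ and $s_1<s_2$. Let $<_\ell$ be any relation that restricted to $G_H$ and to $G_V$ is a linear order extending $<_b$, with elements of different sides incomparable; $\le_\ell$ is its reflexive version. -}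

module Defs where

open import Data.Nat using (ℕ; _≤_)
open import Data.Fin using (Fin)
open import Data.Maybe using (just)
open import Data.List using (List; []; _∷_; _++_; head; last; length)
open import Data.List.Membership.Propositional using (_∈_)
open import Data.List.Relation.Unary.Linked using (Linked)
open import Data.List.Relation.Unary.Unique.Propositional using (Unique)
open import Data.Product using (Σ; ∃; _×_; _,_)
open import Data.Sum using (_⊎_; inj₁; inj₂)
open import Data.Empty using (⊥)
open import Relation.Nullary using (¬_)
open import Relation.Binary.PropositionalEquality using (_≡_; _≢_)
open import Relation.Binary.Structures using (IsStrictTotalOrder)

IsPath : {V : Set} → (V → V → Set) → List V → Set
IsPath adj xs = Linked adj xs × Unique xs × xs ≢ []

PathBetween : {V : Set} → (V → V → Set) → V → V → List V → Set
PathBetween adj a b xs = IsPath adj xs × head xs ≡ just a × last xs ≡ just b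

Connected : {V : Set} → (V → V → Set) → Set
Connected {V} adj = (a b : V) → ∃ λ xs → PathBetween adj a b xs

-- a cycle x ∷ ys : at least 3 distinct vertices, consecutive adjacent, last adjacent to first
IsCycle : {V : Set} → (V → V → Set) → V → List V → Set
IsCycle adj x ys = 2 ≤ length ys × Unique (x ∷ ys) × Linked adj ((x ∷ ys) ++ (x ∷ []))

Acyclic : {V : Set} → (V → V → Set) → Set
Acyclic {V} adj = (x : V) (ys : List V) → ¬ IsCycle adj x ys

IsSimple : {V : Set} → (V → V → Set) → Set
IsSimple {V} adj = ((x y : V) → adj x y → adj y x) × ((x : V) → ¬ adj x x)

IsTree : {V : Set} → (V → V → Set) → Set
IsTree adj = IsSimple adj × Connected adj × Acyclic adj

IsLeaf : {V : Set} → (V → V → Set) → V → Set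
IsLeaf {V} adj v = (y z : V) → adj v y → adj v z → y ≡ z

IsPathVertexSet : {V : Set} → (V → V → Set) → (V → Set) → Set
IsPathVertexSet {V} adj S =
  ∃ λ xs → IsPath adj xs × ((x : V) → (S x → x ∈ xs) × (x ∈ xs → S x))

BipAdj : {m n : ℕ} → (Fin m → Fin n → Set) → Fin m ⊎ Fin n → Fin m ⊎ Fin n → Set
BipAdj E (inj₁ h) (inj₁ h') = ⊥
BipAdj E (inj₁ h) (inj₂ v)  = E h v
BipAdj E (inj₂ v) (inj₁ h)  = E h v
BipAdj E (inj₂ v) (inj₂ v') = ⊥

-- Tree-path intersection graph with parts G_H = Fin m, G_V = Fin n;
-- E h v means hv ∈ E(G); TH, TV are the adjacency relations of T_H, T_V.
record TreePathIntersectionGraph (m n : ℕ) : Set₁ where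
  field
    E  : Fin m → Fin n → Set
    TH : Fin m → Fin m → Set
    TV : Fin n → Fin n → Set
    connected : Connected (BipAdj E)
    TH-tree : IsTree TH
    TV-tree : IsTree TV
    ΓH-path : (h : Fin m) → IsPathVertexSet TV (λ v → E h v)
    ΓV-path : (v : Fin n) → IsPathVertexSet TH (λ h → E h v)

RootLe : {V : Set} → (V → V → Set) → V → V → V → Set
RootLe adj r a b = ∃ λ xs → PathBetween adj r b xs × a ∈ xs

RootLt : {V : Set} → (V → V → Set) → V → V → V → Set
RootLt adj r a b = RootLe adj r a b × a ≢ b

IsMinimal : {V : Set} → (V → V → Set) → (V → Set) → V → Set
IsMinimal {V} le S x = S x × ((y : V) → S y → le y x → y ≡ x)

-- the order <_b on one side: s ranges over W, neighbourhoods lie in V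
-- (leW/ltW: rooted order on W; leV/ltV: rooted order on V; Γ s = neighbourhood)
LtB : {W V : Set} → (W → W → Set) → (V → V → Set) → (V → V → Set) →
      (W → V → Set) → W → W → Set
LtB ltW leV ltV Γ s₁ s₂ =
  ∃ λ x₁ → ∃ λ x₂ → IsMinimal leV (Γ s₁) x₁ × IsMinimal leV (Γ s₂) x₂ ×
    (ltV x₁ x₂ ⊎ (x₁ ≡ x₂ × ltW s₁ s₂))

module Rooted {m n : ℕ} (G : TreePathIntersectionGraph m n) (hroot : Fin m) (vroot : Fin n) where
  open TreePathIntersectionGraph G

  _≤H_ _<H_ : Fin m → Fin m → Set
  _≤H_ = RootLe TH hroot
  _<H_ = RootLt TH hroot

  _≤V_ _<V_ : Fin n → Fin n → Set
  _≤V_ = RootLe TV vroot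
  _<V_ = RootLt TV vroot

  _<bH_ : Fin m → Fin m → Set
  _<bH_ = LtB _<H_ _≤V_ _<V_ (λ h v → E h v)

  _<bV_ : Fin n → Fin n → Set
  _<bV_ = LtB _<V_ _≤H_ _<H_ (λ v h → E h v)

  -- <_ℓ restricted to a side: a strict linear order extending <_b
  IsLinExtH : (Fin m → Fin m → Set) → Set
  IsLinExtH L = IsStrictTotalOrder _≡_ L × ((a b : Fin m) → a <bH b → L a b)

  IsLinExtV : (Fin n → Fin n → Set) → Set
  IsLinExtV L = IsStrictTotalOrder _≡_ L × ((a b : Fin n) → a <bV b → L a b)

ReflClosure : {A : Set} → (A → A → Set) → A → A → Set
ReflClosure L a b = a ≡ b ⊎ L a b

{-# OPTIONS --safe #-}
module Submission where

-- Write μ(s) for the least element of the path Γ(s) in the rooted tree on the other side.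
-- The basic fact is that no tree edges a b of T_V and q x of T_H (b, x the children) can
-- have all common neighbours of a, b below x and all common neighbours of q, x below b:
-- the vertices outside both subtrees and not adjacent to them would then be closed under
-- adjacency in G and contain the root edge but not x, contradicting connectedness.  It makes μ monotone along each tree
-- for vertices with a common neighbour, so a strict ancestor precedes its descendants in <_b,
-- and h₁ ≤_ℓ h₂, v₁ ≤_ℓ v₂ force μ(h₁) ≤ μ(h₂) and μ(v₁) ≤ μ(v₂).  If h₁, h₂ or v₁, v₂ are
-- comparable, convexity of Γ(v₁) or Γ(h₁) gives h₁ v₁ ∈ E(G).  Otherwise both pairs branch,
-- at z in T_H and w in T_V; then z ∈ Γ(v₁) ∩ Γ(v₂) and w ∈ Γ(h₁) ∩ Γ(h₂), and since a path
-- visits at most two neighbours of a vertex, Γ(w) lies below z and Γ(z) below w.  As w has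
-- two children it is not the leaf v_root, so the edges into z and w contradict the basic fact.

open import Data.Empty using (⊥; ⊥-elim)
open import Data.Fin using (Fin; _≟_)
open import Data.List using (List; []; _∷_; _++_; _∷ʳ_; [_]; head; last; length; reverse; initLast; _∷ʳ′_)
open import Data.List.Extrema.Nat using (argmin; argmin-sel; f[argmin]≤f[⊤]; f[argmin]≤f[xs])
open import Data.List.Properties
  using (++-assoc; ++-identityʳ; ++-cancelˡ; ++-conicalˡ; ∷-injectiveˡ; ∷-injectiveʳ; ∷ʳ-injectiveˡ; ∷ʳ-injectiveʳ;
         length-++; reverse-++; unfold-reverse)
open import Data.List.Membership.Propositional using (_∈_; _∉_)
open import Data.List.Membership.Propositional.Properties using (∈-++⁺ˡ; ∈-++⁺ʳ; ∈-++⁻; ∈-∃++)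
open import Data.List.Relation.Binary.Disjoint.Propositional using (Disjoint)
open import Data.List.Relation.Unary.All as All using (All; []; _∷_)
import Data.List.Relation.Unary.All.Properties as All
open import Data.List.Relation.Unary.Any using (here; there)
open import Data.List.Relation.Unary.Any.Properties using (reverse⁻)
open import Data.List.Relation.Unary.Linked as Linked using (Linked; []; [-]; _∷_)
import Data.List.Relation.Unary.Linked.Properties as Linked
open import Data.List.Relation.Unary.Unique.Propositional using (Unique; []; _∷_)
open import Data.List.Relation.Unary.Unique.Propositional.Properties as Unique using (Unique[x∷xs]⇒x∉xs)
open import Data.Maybe using (just)
open import Data.Maybe.Properties using (just-injective)
open import Data.Maybe.Relation.Binary.Connected as Maybe using (just)
open import Data.Nat using (ℕ; suc; _≤_; _<_; s≤s; z≤n)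
open import Data.Nat.Properties using (<-≤-trans; n≮n; m<m+n; +-comm; 1+n≢n; m≢1+n+m)
open import Data.Product using (∃; ∃₂; _×_; _,_; proj₁; proj₂; uncurry)
open import Data.Sum using (_⊎_; inj₁; inj₂)
open import Function using (_∘_)
open import Relation.Binary.Definitions using (DecidableEquality)
open import Relation.Binary.PropositionalEquality using (_≡_; _≢_; refl; sym; trans; cong; subst; module ≡-Reasoning)
open import Relation.Binary.Structures using (IsStrictPartialOrder; IsStrictTotalOrder)
open import Relation.Nullary using (¬_; Dec; yes; no)

open import Defs

module _ {A : Set} where

  last-∷ʳ : ∀ (xs : List A) x → last (xs ∷ʳ x) ≡ just x
  last-∷ʳ []           x = refl
  last-∷ʳ (_ ∷ [])     x = refl
  last-∷ʳ (_ ∷ y ∷ xs) x = last-∷ʳ (y ∷ xs) x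

  last-++-∷ : ∀ (xs : List A) y ys → last (xs ++ y ∷ ys) ≡ last (y ∷ ys)
  last-++-∷ []           y ys = refl
  last-++-∷ (_ ∷ [])     y ys = refl
  last-++-∷ (_ ∷ x ∷ xs) y ys = last-++-∷ (x ∷ xs) y ys

  head-++ : ∀ {x} (xs : List A) {ys} → head xs ≡ just x → head (xs ++ ys) ≡ just x
  head-++ (_ ∷ _) eq = eq

  last⇒∷ʳ : ∀ {x} (xs : List A) → last xs ≡ just x → ∃ λ ys → xs ≡ ys ∷ʳ x
  last⇒∷ʳ xs eq with initLast xs
  last⇒∷ʳ .(ys ∷ʳ y) eq | ys ∷ʳ′ y with refl ← trans (sym (last-∷ʳ ys y)) eq = ys , refl

  last-∈ : ∀ {x} (xs : List A) → last xs ≡ just x → x ∈ xs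
  last-∈ xs eq with ys , refl ← last⇒∷ʳ xs eq = ∈-++⁺ʳ ys (here refl)

  ++-self-extension : ∀ (xs ys zs : List A) → xs ≡ (xs ++ ys) ++ zs → ys ≡ []
  ++-self-extension []       ys zs eq = ++-conicalˡ ys zs (sym eq)
  ++-self-extension (x ∷ xs) ys zs eq = ++-self-extension xs ys zs (∷-injectiveʳ eq)

  least : (f : A → ℕ) → ∀ xs → xs ≢ [] → ∃ λ m → m ∈ xs × (∀ {u} → u ∈ xs → f m ≤ f u)
  least f []       []≢[] = ⊥-elim ([]≢[] refl)
  least f (x ∷ xs) _     = argmin f x xs , argmin-∈ , argmin-≤
    where
    argmin-∈ : argmin f x xs ∈ x ∷ xs
    argmin-∈ with argmin-sel f x xs
    ... | inj₁ eq = here eq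
    ... | inj₂ m∈ = there m∈
    argmin-≤ : ∀ {u} → u ∈ x ∷ xs → f (argmin f x xs) ≤ f u
    argmin-≤ (here refl) = f[argmin]≤f[⊤] {f = f} x xs
    argmin-≤ (there u∈)  = All.lookup (f[argmin]≤f[xs] {f = f} x xs) u∈

  Unique-++⁻ˡ : ∀ (xs : List A) {ys} → Unique (xs ++ ys) → Unique xs
  Unique-++⁻ˡ []       _        = []
  Unique-++⁻ˡ (x ∷ xs) (x∉ ∷ u) = All.++⁻ˡ xs x∉ ∷ Unique-++⁻ˡ xs u

  Unique-prefix : ∀ (xs : List A) {x ys} → Unique (xs ++ x ∷ ys) → Unique (xs ∷ʳ x)
  Unique-prefix xs {x} {ys} u = Unique-++⁻ˡ (xs ∷ʳ x) (subst Unique (sym (++-assoc xs [ x ] ys)) u)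

  Unique-++⁻ʳ : ∀ (xs : List A) {ys} → Unique (xs ++ ys) → Unique ys
  Unique-++⁻ʳ []       u       = u
  Unique-++⁻ʳ (x ∷ xs) (_ ∷ u) = Unique-++⁻ʳ xs u

  Unique-++⁻-disjoint : ∀ (xs : List A) {ys} → Unique (xs ++ ys) → Disjoint xs ys
  Unique-++⁻-disjoint (x ∷ xs) (x∉ ∷ _) (here refl , v∈ys) = All.lookup (All.++⁻ʳ xs x∉) v∈ys refl
  Unique-++⁻-disjoint (x ∷ xs) (_ ∷ u)  (there v∈xs , v∈ys) = Unique-++⁻-disjoint xs u (v∈xs , v∈ys)

  Unique-∷ : ∀ {x} {xs : List A} → x ∉ xs → Unique xs → Unique (x ∷ xs)
  Unique-∷ x∉ u = All.¬Any⇒All¬ _ x∉ ∷ u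

  Unique-reverse : ∀ {xs : List A} → Unique xs → Unique (reverse xs)
  Unique-reverse {[]}     u        = u
  Unique-reverse {x ∷ xs} (x∉ ∷ u) = subst Unique (sym (unfold-reverse x xs))
    (Unique.++⁺ (Unique-reverse u) ([] ∷ [])
      λ { (v∈ , here refl) → All.lookup x∉ (reverse⁻ v∈) refl })

  module _ {R : A → A → Set} where

    Linked-prefix : ∀ (xs : List A) {x ys} → Linked R (xs ++ x ∷ ys) → Linked R (xs ∷ʳ x)
    Linked-prefix []           _       = [-]
    Linked-prefix (_ ∷ [])     (r ∷ _) = r ∷ [-]
    Linked-prefix (_ ∷ y ∷ xs) (r ∷ l) = r ∷ Linked-prefix (y ∷ xs) l

    Linked-++⁻ʳ : ∀ (xs : List A) {ys} → Linked R (xs ++ ys) → Linked R ys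
    Linked-++⁻ʳ []       l = l
    Linked-++⁻ʳ (x ∷ xs) l = Linked-++⁻ʳ xs (Linked.tail l)

    Linked-glue : ∀ (xs : List A) {x ys} → Linked R (xs ∷ʳ x) → Linked R (x ∷ ys) → Linked R (xs ++ x ∷ ys)
    Linked-glue []           _       l = l
    Linked-glue (_ ∷ [])     (r ∷ _) l = r ∷ l
    Linked-glue (_ ∷ y ∷ xs) (r ∷ k) l = r ∷ Linked-glue (y ∷ xs) k l

    Linked-reverse : (∀ {x y} → R x y → R y x) → ∀ {xs} → Linked R xs → Linked R (reverse xs)
    Linked-reverse R-sym []  = []
    Linked-reverse R-sym [-] = [-]
    Linked-reverse R-sym {x ∷ y ∷ xs} (r ∷ l) =
      subst (Linked R) (sym (unfold-reverse x (y ∷ xs)))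
        (Linked.++⁺ (Linked-reverse R-sym l) last-linked [-])
      where
      last-linked : Maybe.Connected R (last (reverse (y ∷ xs))) (just x)
      last-linked rewrite unfold-reverse y xs | last-∷ʳ (reverse xs) y = just (R-sym r)

  Linked-propagate : ∀ {R : A → A → Set} {P : A → Set} → (∀ {x y} → R x y → P x → P y) →
                     ∀ {x xs y} → Linked R (x ∷ xs) → last (x ∷ xs) ≡ just y → P x → P y
  Linked-propagate step {xs = []}    _       refl px = px
  Linked-propagate step {xs = _ ∷ _} (r ∷ l) eq   px = Linked-propagate step l eq (step r px)

  data CommonPrefix (xs ys : List A) : Set where
    prefixˡ : ∀ zs → ys ≡ xs ++ zs → CommonPrefix xs ys
    prefixʳ : ∀ zs → xs ≡ ys ++ zs → CommonPrefix xs ys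
    diverge : ∀ zs {x y} xs′ ys′ → x ≢ y → xs ≡ zs ++ x ∷ xs′ → ys ≡ zs ++ y ∷ ys′ → CommonPrefix xs ys

  commonPrefix : DecidableEquality A → ∀ xs ys → CommonPrefix xs ys
  commonPrefix _≟_ []       ys       = prefixˡ ys refl
  commonPrefix _≟_ (x ∷ xs) []       = prefixʳ (x ∷ xs) refl
  commonPrefix _≟_ (x ∷ xs) (y ∷ ys) with x ≟ y
  ... | no x≢y = diverge [] xs ys x≢y refl refl
  ... | yes refl with commonPrefix _≟_ xs ys
  ... | prefixˡ zs eq = prefixˡ zs (cong (x ∷_) eq)
  ... | prefixʳ zs eq = prefixʳ zs (cong (x ∷_) eq)
  ... | diverge zs xs′ ys′ x≢y eq₁ eq₂ = diverge (x ∷ zs) xs′ ys′ x≢y (cong (x ∷_) eq₁) (cong (x ∷_) eq₂)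

  first-satisfying : ∀ {P : A → Set} → (∀ x → Dec (P x)) → ∀ {xs y} → y ∈ xs → P y →
                     ∃₂ λ ys zs → ∃ λ k → xs ≡ ys ++ k ∷ zs × P k × All (λ z → ¬ P z) ys
  first-satisfying P? {x ∷ xs} y∈ py with P? x
  ... | yes px = [] , xs , x , refl , px , []
  first-satisfying P? {x ∷ xs} (here refl) py | no ¬px = ⊥-elim (¬px py)
  first-satisfying P? {x ∷ xs} (there y∈)  py | no ¬px
    with ys , zs , k , refl , pk , before ← first-satisfying P? y∈ py
    = x ∷ ys , zs , k , refl , pk , ¬px ∷ before

module RootedTree {V : Set} (_≟_ : DecidableEquality V) (adj : V → V → Set) (tree : IsTree adj) (root : V) where

  open import Data.List.Membership.DecPropositional _≟_ using (_∈?_)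

  adj-sym : ∀ {x y} → adj x y → adj y x
  adj-sym = proj₁ (proj₁ tree) _ _

  adj-irrefl : ∀ {x} → ¬ adj x x
  adj-irrefl = proj₂ (proj₁ tree) _

  record Path (a : V) (xs : List V) (b : V) : Set where
    field
      linked : Linked adj xs
      unique : Unique xs
      head≡  : head xs ≡ just a
      last≡  : last xs ≡ just b
  open Path

  fromPathBetween : ∀ {a b xs} → PathBetween adj a b xs → Path a xs b
  fromPathBetween ((l , u , _) , h , e) = record { linked = l ; unique = u ; head≡ = h ; last≡ = e }

  toPathBetween : ∀ {a b xs} → Path a xs b → PathBetween adj a b xs
  toPathBetween {xs = _ ∷ _} p = (linked p , unique p , λ ()) , head≡ p , last≡ p

  private
    length-∷-pos : ∀ (xs : List V) {y ys} → 1 ≤ length (xs ++ y ∷ ys)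
    length-∷-pos []      = s≤s z≤n
    length-∷-pos (_ ∷ _) = s≤s z≤n

    reverse-∷ʳ : ∀ (xs : List V) x → reverse (xs ∷ʳ x) ≡ x ∷ reverse xs
    reverse-∷ʳ xs x = reverse-++ xs [ x ]

    last-exists : ∀ (x : V) xs → ∃ λ c → last (x ∷ xs) ≡ just c
    last-exists x []       = x , refl
    last-exists x (y ∷ xs) = last-exists y xs

  private
    closed-walk-linked : ∀ {x k} (P Q : List V) → Linked adj ((x ∷ P) ∷ʳ k) → Linked adj ((x ∷ Q) ∷ʳ k) →
                         Linked adj ((x ∷ P ++ k ∷ reverse Q) ++ [ x ])
    closed-walk-linked {x} {k} P Q lP lQ =
      subst (λ L → Linked adj (x ∷ L)) (sym (++-assoc P (k ∷ reverse Q) [ x ]))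
        (Linked-glue (x ∷ P) lP (subst (Linked adj) reversed-Q (Linked-reverse adj-sym lQ)))
      where
      reversed-Q : reverse ((x ∷ Q) ∷ʳ k) ≡ k ∷ reverse Q ∷ʳ x
      reversed-Q = trans (reverse-∷ʳ (x ∷ Q) k) (cong (k ∷_) (unfold-reverse x Q))

    closed-walk-unique : ∀ {x k} (P Q : List V) → Unique ((x ∷ P) ∷ʳ k) → Unique ((x ∷ Q) ∷ʳ k) → Disjoint P Q →
                         Unique (x ∷ P ++ k ∷ reverse Q)
    closed-walk-unique {x} {k} P Q uP@(_ ∷ uP′) uQ@(_ ∷ uQ′) P∩Q =
      Unique-∷ x∉walk (Unique.++⁺ (Unique-++⁻ˡ P uP′)
        (Unique-∷ (k∉Q ∘ reverse⁻ {xs = Q}) (Unique-reverse (Unique-++⁻ˡ Q uQ′)))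
        λ { (w∈P , here refl) → k∉P w∈P ; (w∈P , there w∈Q) → P∩Q (w∈P , reverse⁻ {xs = Q} w∈Q) })
      where
      k∉P : k ∉ P
      k∉P k∈P = Unique-++⁻-disjoint P uP′ (k∈P , here refl)
      k∉Q : k ∉ Q
      k∉Q k∈Q = Unique-++⁻-disjoint Q uQ′ (k∈Q , here refl)
      x∉walk : x ∉ P ++ k ∷ reverse Q
      x∉walk x∈ with ∈-++⁻ P x∈
      ... | inj₁ x∈P         = Unique[x∷xs]⇒x∉xs uP (∈-++⁺ˡ x∈P)
      ... | inj₂ (here refl) = Unique[x∷xs]⇒x∉xs uP (∈-++⁺ʳ P (here refl))
      ... | inj₂ (there x∈Q) = Unique[x∷xs]⇒x∉xs uQ (∈-++⁺ˡ (reverse⁻ {xs = Q} x∈Q))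

  -- Walking out of x along two different edges, the first vertex k of the first
  -- walk that the second walk reaches closes the cycle x ∷ P₁ ++ k ∷ reverse Q₁.
  no-fork : ∀ {x y z} p q → y ≢ z →
            Linked adj (x ∷ y ∷ p) → Unique (x ∷ y ∷ p) →
            Linked adj (x ∷ z ∷ q) → Unique (x ∷ z ∷ q) →
            last (y ∷ p) ≡ last (z ∷ q) → ⊥
  no-fork {x} {y} {z} p q y≢z lp up lq uq same-end
    with c , c-end ← last-exists y p
    with P₁ , P₂ , k , p-split , k∈q , P₁∉q ←
           first-satisfying (_∈? z ∷ q) (last-∈ (y ∷ p) c-end) (last-∈ (z ∷ q) (trans (sym same-end) c-end))
    with Q₁ , Q₂ , q-split ← ∈-∃++ k∈q
    = proj₂ (proj₂ tree) x (P₁ ++ k ∷ reverse Q₁)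
        ( long P₁ Q₁ p-split q-split
        , closed-walk-unique P₁ Q₁ (Unique-prefix (x ∷ P₁) (subst Unique P-split up))
                                   (Unique-prefix (x ∷ Q₁) (subst Unique Q-split uq)) P₁∩Q₁
        , closed-walk-linked P₁ Q₁ (Linked-prefix (x ∷ P₁) (subst (Linked adj) P-split lp))
                                   (Linked-prefix (x ∷ Q₁) (subst (Linked adj) Q-split lq)))
    where
    P-split : x ∷ y ∷ p ≡ (x ∷ P₁) ++ k ∷ P₂
    P-split = cong (x ∷_) p-split
    Q-split : x ∷ z ∷ q ≡ (x ∷ Q₁) ++ k ∷ Q₂
    Q-split = cong (x ∷_) q-split
    P₁∩Q₁ : Disjoint P₁ Q₁
    P₁∩Q₁ (w∈P₁ , w∈Q₁) = All.lookup P₁∉q w∈P₁ (subst (_ ∈_) (sym q-split) (∈-++⁺ˡ w∈Q₁))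
    long : ∀ P₁ Q₁ → y ∷ p ≡ P₁ ++ k ∷ P₂ → z ∷ q ≡ Q₁ ++ k ∷ Q₂ → 2 ≤ length (P₁ ++ k ∷ reverse Q₁)
    long (_ ∷ P₁) _        _    _    = s≤s (length-∷-pos P₁)
    long []       []       refl refl = ⊥-elim (y≢z refl)
    long []       (_ ∷ Q₁) refl _    =
      s≤s (subst (λ L → 1 ≤ length L) (sym (unfold-reverse _ Q₁)) (length-∷-pos (reverse Q₁)))

  private
    tails-unique : ∀ x p q → Linked adj (x ∷ p) → Unique (x ∷ p) → Linked adj (x ∷ q) → Unique (x ∷ q) →
                   last (x ∷ p) ≡ last (x ∷ q) → p ≡ q
    tails-unique x []      []      _ _  _ _  _   = refl
    tails-unique x []      (z ∷ q) _ _  _ uq end = ⊥-elim (Unique[x∷xs]⇒x∉xs uq (last-∈ (z ∷ q) (sym end)))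
    tails-unique x (y ∷ p) []      _ up _ _  end = ⊥-elim (Unique[x∷xs]⇒x∉xs up (last-∈ (y ∷ p) end))
    tails-unique x (y ∷ p) (z ∷ q) lp up@(_ ∷ up′) lq uq@(_ ∷ uq′) end with y ≟ z
    ... | yes refl = cong (y ∷_) (tails-unique y p q (Linked.tail lp) up′ (Linked.tail lq) uq′ end)
    ... | no y≢z   = ⊥-elim (no-fork p q y≢z lp up lq uq end)

  path-unique : ∀ {a b xs ys} → Path a xs b → Path a ys b → xs ≡ ys
  path-unique {xs = x ∷ p} {ys = y ∷ q} P Q with refl ← just-injective (trans (head≡ P) (sym (head≡ Q))) =
    cong (x ∷_) (tails-unique x p q (linked P) (unique P) (linked Q) (unique Q)
                              (trans (last≡ P) (sym (last≡ Q))))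

  Path-prefix : ∀ {a b L} xs c ys → L ≡ xs ++ c ∷ ys → Path a L b → Path a (xs ∷ʳ c) c
  Path-prefix {a} xs c ys refl P = record
    { linked = Linked-prefix xs (linked P)
    ; unique = Unique-prefix xs (unique P)
    ; head≡  = head-prefix xs (head≡ P)
    ; last≡  = last-∷ʳ xs c
    }
    where
    head-prefix : ∀ xs → head (xs ++ c ∷ ys) ≡ just a → head (xs ∷ʳ c) ≡ just a
    head-prefix []      h = h
    head-prefix (_ ∷ _) h = h

  Path-reverse : ∀ {a b xs} → Path a xs b → Path b (reverse xs) a
  Path-reverse {a} {b} {x ∷ xs} P with ys , eq ← last⇒∷ʳ (x ∷ xs) (last≡ P) = record
    { linked = Linked-reverse adj-sym (linked P)
    ; unique = Unique-reverse (unique P)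
    ; head≡  = cong head (trans (cong reverse eq) (reverse-∷ʳ ys b))
    ; last≡  = trans (cong last (unfold-reverse x xs)) (trans (last-∷ʳ (reverse xs) x) (head≡ P))
    }

  segment : ∀ {L} xs c ys d zs → L ≡ xs ++ c ∷ ys ++ d ∷ zs → Linked adj L → Unique L → Path c (c ∷ ys ∷ʳ d) d
  segment xs c ys d zs refl l u = Path-prefix (c ∷ ys) d zs refl record
    { linked = Linked-++⁻ʳ xs l
    ; unique = Unique-++⁻ʳ xs u
    ; head≡  = refl
    ; last≡  = trans (last-++-∷ (c ∷ ys) d zs) (proj₂ (last-exists d zs))
    }

  Path-join : ∀ {a b c L ys} → Path a L c → Path c (c ∷ ys) b → Disjoint L ys → Path a (L ++ ys) b
  Path-join {c = c} {L} {ys} P Q disjoint with xs , refl ← last⇒∷ʳ L (last≡ P) = record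
    { linked = subst (Linked adj) (sym (++-assoc xs [ c ] ys)) (Linked-glue xs (linked P) (linked Q))
    ; unique = Unique.++⁺ (unique P) (Unique-++⁻ʳ [ c ] (unique Q)) disjoint
    ; head≡  = head-++ (xs ∷ʳ c) (head≡ P)
    ; last≡  = trans (cong last (++-assoc xs [ c ] ys)) (trans (last-++-∷ xs c ys) (last≡ Q))
    }

  Path-starts : ∀ {a b xs} → Path a xs b → ∃ λ ys → xs ≡ a ∷ ys
  Path-starts {xs = x ∷ ys} P with refl ← just-injective (head≡ P) = ys , refl

  vertex-path : ∀ {x} → Path x [ x ] x
  vertex-path = record { linked = [-] ; unique = [] ∷ [] ; head≡ = refl ; last≡ = refl }

  edge-path : ∀ {x y} → adj x y → Path x (x ∷ y ∷ []) y
  edge-path xy = record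
    { linked = xy ∷ [-] ; unique = ((λ { refl → adj-irrefl xy }) ∷ []) ∷ [] ∷ [] ; head≡ = refl ; last≡ = refl }

  rootPath : V → List V
  rootPath b = proj₁ (proj₁ (proj₂ tree) root b)

  rootPath-path : ∀ b → Path root (rootPath b) b
  rootPath-path b = fromPathBetween (proj₂ (proj₁ (proj₂ tree) root b))

  rootPath-unique : ∀ {b xs} → Path root xs b → xs ≡ rootPath b
  rootPath-unique P = path-unique P (rootPath-path _)

  rootPath-injective : ∀ {a b} → rootPath a ≡ rootPath b → a ≡ b
  rootPath-injective {a} {b} eq =
    just-injective (trans (sym (last≡ (rootPath-path a))) (trans (cong last eq) (last≡ (rootPath-path b))))

  infix 4 _⊑_ _⊑?_

  _⊑_ : V → V → Set
  a ⊑ b = a ∈ rootPath b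

  _⊑?_ : ∀ a b → Dec (a ⊑ b)
  a ⊑? b = a ∈? rootPath b

  ⊑⇒RootLe : ∀ {a b} → a ⊑ b → RootLe adj root a b
  ⊑⇒RootLe {b = b} a⊑b = rootPath b , toPathBetween (rootPath-path b) , a⊑b

  RootLe⇒⊑ : ∀ {a b} → RootLe adj root a b → a ⊑ b
  RootLe⇒⊑ (xs , P , a∈xs) = subst (_ ∈_) (rootPath-unique (fromPathBetween P)) a∈xs

  ⊑-refl : ∀ {a} → a ⊑ a
  ⊑-refl {a} = last-∈ (rootPath a) (last≡ (rootPath-path a))

  rootPath-extends : ∀ {a b} → a ⊑ b → ∃ λ zs → rootPath b ≡ rootPath a ++ zs
  rootPath-extends {a} {b} a⊑b with xs , ys , eq ← ∈-∃++ a⊑b =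
    ys , trans eq (trans (sym (++-assoc xs [ a ] ys))
                         (cong (_++ ys) (rootPath-unique (Path-prefix xs a ys eq (rootPath-path b)))))

  ⊑-trans : ∀ {a b c} → a ⊑ b → b ⊑ c → a ⊑ c
  ⊑-trans a⊑b b⊑c with zs , eq ← rootPath-extends b⊑c = subst (_ ∈_) (sym eq) (∈-++⁺ˡ a⊑b)

  ⊑-antisym : ∀ {a b} → a ⊑ b → b ⊑ a → a ≡ b
  ⊑-antisym {a} {b} a⊑b b⊑a
    with ys , eqb ← rootPath-extends a⊑b | zs , eqa ← rootPath-extends b⊑a
    with refl ← ++-self-extension (rootPath b) zs ys (trans eqb (cong (_++ ys) eqa))
    = rootPath-injective (trans eqa (++-identityʳ (rootPath b)))

  ⊑-comparable : ∀ {a b c} → a ⊑ c → b ⊑ c → a ⊑ b ⊎ b ⊑ a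
  ⊑-comparable {a} {b} a⊑c b⊑c with commonPrefix _≟_ (rootPath a) (rootPath b)
  ... | prefixˡ zs eq = inj₁ (subst (a ∈_) (sym eq) (∈-++⁺ˡ ⊑-refl))
  ... | prefixʳ zs eq = inj₂ (subst (b ∈_) (sym eq) (∈-++⁺ˡ ⊑-refl))
  ... | diverge zs {x} {y} xs ys x≢y eqa eqb
    with A , eqA ← rootPath-extends a⊑c | B , eqB ← rootPath-extends b⊑c
    = ⊥-elim (x≢y (∷-injectiveˡ (++-cancelˡ zs (x ∷ xs ++ A) (y ∷ ys ++ B) same-extension)))
    where
    open ≡-Reasoning
    same-extension : zs ++ x ∷ xs ++ A ≡ zs ++ y ∷ ys ++ B
    same-extension = begin
      zs ++ x ∷ xs ++ A    ≡⟨ ++-assoc zs (x ∷ xs) A ⟨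
      (zs ++ x ∷ xs) ++ A  ≡⟨ cong (_++ A) eqa ⟨
      rootPath a ++ A      ≡⟨ eqA ⟨
      rootPath _           ≡⟨ eqB ⟩
      rootPath b ++ B      ≡⟨ cong (_++ B) eqb ⟩
      (zs ++ y ∷ ys) ++ B  ≡⟨ ++-assoc zs (y ∷ ys) B ⟩
      zs ++ y ∷ ys ++ B    ∎

  rootPath-root : rootPath root ≡ [ root ]
  rootPath-root = sym (rootPath-unique vertex-path)

  ⊑-root : ∀ {b} → b ⊑ root → b ≡ root
  ⊑-root b⊑root with here b≡root ← subst (_ ∈_) rootPath-root b⊑root = b≡root

  ⊑-≢⇒nonroot : ∀ {a b} → a ⊑ b → a ≢ b → b ≢ root
  ⊑-≢⇒nonroot {a} a⊑b a≢b refl = a≢b (⊑-root a⊑b)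

  depth : V → ℕ
  depth b = length (rootPath b)

  depth-< : ∀ {a b} → a ⊑ b → a ≢ b → depth a < depth b
  depth-< {a} {b} a⊑b a≢b with rootPath-extends a⊑b
  ... | []     , eq = ⊥-elim (a≢b (rootPath-injective (sym (trans eq (++-identityʳ (rootPath a))))))
  ... | x ∷ zs , eq = subst (depth a <_) (sym (trans (cong length eq) (length-++ (rootPath a))))
                            (m<m+n (depth a) (s≤s z≤n))

  Parent : V → V → Set
  Parent a b = rootPath b ≡ rootPath a ∷ʳ b

  Parent⇒⊑ : ∀ {a b} → Parent a b → a ⊑ b
  Parent⇒⊑ eq = subst (_ ∈_) (sym eq) (∈-++⁺ˡ ⊑-refl)

  Parent⇒depth : ∀ {a b} → Parent a b → depth b ≡ suc (depth a)
  Parent⇒depth {a} {b} eq = trans (cong length eq) (trans (length-++ (rootPath a)) (+-comm (depth a) 1))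

  Parent⇒≢ : ∀ {a b} → Parent a b → a ≢ b
  Parent⇒≢ eq refl = 1+n≢n (sym (Parent⇒depth eq))

  Parent⇒nonroot : ∀ {a b} → Parent a b → b ≢ root
  Parent⇒nonroot eq refl = Parent⇒≢ eq (⊑-root (Parent⇒⊑ eq))

  grandparent-≢ : ∀ {a b c} → Parent a b → Parent b c → a ≢ c
  grandparent-≢ ab bc refl = m≢1+n+m _ {1} (trans (Parent⇒depth bc) (cong suc (Parent⇒depth ab)))

  Parent⇒adj : ∀ {a b} → Parent a b → adj a b
  Parent⇒adj {a} {b} eq with xs , eqa ← last⇒∷ʳ (rootPath a) (last≡ (rootPath-path a)) =
    Linked.head (Linked-++⁻ʳ xs (subst (Linked adj) path-shape (linked (rootPath-path b))))
    where
    path-shape : rootPath b ≡ xs ++ a ∷ b ∷ []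
    path-shape = trans eq (trans (cong (_∷ʳ b) eqa) (++-assoc xs [ a ] [ b ]))

  ⊑-parent : ∀ {a b y} → Parent a b → y ⊑ b → y ≢ b → y ⊑ a
  ⊑-parent eq y⊑b y≢b with ∈-++⁻ (rootPath _) (subst (_ ∈_) eq y⊑b)
  ... | inj₁ y⊑a         = y⊑a
  ... | inj₂ (here refl) = ⊥-elim (y≢b refl)

  parent : ∀ {b} → b ≢ root → ∃ λ a → Parent a b
  parent {b} b≢root with xs , eqb ← last⇒∷ʳ (rootPath b) (last≡ (rootPath-path b)) with initLast xs
  ... | [] = ⊥-elim (b≢root (just-injective (trans (sym (cong head eqb)) (head≡ (rootPath-path b)))))
  ... | ys ∷ʳ′ a = a , trans eqb (cong (_∷ʳ b) (rootPath-unique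
          (Path-prefix ys a [ b ] (trans eqb (++-assoc ys [ a ] [ b ])) (rootPath-path b))))

  child-toward : ∀ {a h} → a ⊑ h → a ≢ h → ∃ λ c → Parent a c × c ⊑ h
  child-toward {a} {h} a⊑h a≢h with rootPath-extends a⊑h
  ... | []     , eq = ⊥-elim (a≢h (rootPath-injective (sym (trans eq (++-identityʳ (rootPath a))))))
  ... | c ∷ zs , eq = c , sym (rootPath-unique (Path-prefix (rootPath a) c zs eq (rootPath-path h)))
                        , subst (c ∈_) (sym eq) (∈-++⁺ʳ (rootPath a) (here refl))

  siblings-disjoint : ∀ {a c₁ c₂ h} → Parent a c₁ → Parent a c₂ → c₁ ≢ c₂ → c₁ ⊑ h → c₂ ⊑ h → ⊥
  siblings-disjoint ac₁ ac₂ c₁≢c₂ c₁⊑h c₂⊑h with ⊑-comparable c₁⊑h c₂⊑h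
  ... | inj₁ c₁⊑c₂ = Parent⇒≢ ac₁ (⊑-antisym (Parent⇒⊑ ac₁) (⊑-parent ac₂ c₁⊑c₂ c₁≢c₂))
  ... | inj₂ c₂⊑c₁ = Parent⇒≢ ac₂ (⊑-antisym (Parent⇒⊑ ac₂) (⊑-parent ac₁ c₂⊑c₁ (c₁≢c₂ ∘ sym)))

  record Fork (h₁ h₂ : V) : Set where
    field
      apex child₁ child₂ : V
      parent₁  : Parent apex child₁
      parent₂  : Parent apex child₂
      child₁⊑  : child₁ ⊑ h₁
      child₂⊑  : child₂ ⊑ h₂
      children-differ : child₁ ≢ child₂

    apex⊑₂ : apex ⊑ h₂
    apex⊑₂ = ⊑-trans (Parent⇒⊑ parent₂) child₂⊑

    apex-not-leaf : ¬ IsLeaf adj apex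
    apex-not-leaf leaf = children-differ (leaf child₁ child₂ (Parent⇒adj parent₁) (Parent⇒adj parent₂))

    common-⊑-apex : ∀ {y} → y ⊑ h₁ → y ⊑ h₂ → y ⊑ apex
    common-⊑-apex {y} y⊑h₁ y⊑h₂ with ⊑-comparable y⊑h₁ child₁⊑
    ... | inj₂ c₁⊑y = ⊥-elim (siblings-disjoint parent₁ parent₂ children-differ (⊑-trans c₁⊑y y⊑h₂) child₂⊑)
    ... | inj₁ y⊑c₁ with y ≟ child₁
    ...   | yes refl = ⊥-elim (siblings-disjoint parent₁ parent₂ children-differ y⊑h₂ child₂⊑)
    ...   | no y≢c₁  = ⊑-parent parent₁ y⊑c₁ y≢c₁

  fork : ∀ {h₁ h₂} → ¬ h₁ ⊑ h₂ → ¬ h₂ ⊑ h₁ → Fork h₁ h₂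
  fork {h₁} {h₂} h₁⋢h₂ h₂⋢h₁ with commonPrefix _≟_ (rootPath h₁) (rootPath h₂)
  ... | prefixˡ zs eq = ⊥-elim (h₁⋢h₂ (subst (h₁ ∈_) (sym eq) (∈-++⁺ˡ ⊑-refl)))
  ... | prefixʳ zs eq = ⊥-elim (h₂⋢h₁ (subst (h₂ ∈_) (sym eq) (∈-++⁺ˡ ⊑-refl)))
  ... | diverge zs {c₁} {c₂} xs₁ xs₂ c₁≢c₂ eq₁ eq₂ with initLast zs
  ...   | [] = ⊥-elim (c₁≢c₂ (just-injective (trans (starts-at-root eq₁) (sym (starts-at-root eq₂)))))
    where
    starts-at-root : ∀ {h c xs} → rootPath h ≡ c ∷ xs → just c ≡ just root
    starts-at-root {h} eq = trans (cong head (sym eq)) (head≡ (rootPath-path h))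
  ...   | ys ∷ʳ′ z = record
    { apex = z ; child₁ = c₁ ; child₂ = c₂
    ; parent₁ = child-parent eq₁ ; parent₂ = child-parent eq₂
    ; child₁⊑ = subst (c₁ ∈_) (sym eq₁) (∈-++⁺ʳ (ys ∷ʳ z) (here refl))
    ; child₂⊑ = subst (c₂ ∈_) (sym eq₂) (∈-++⁺ʳ (ys ∷ʳ z) (here refl))
    ; children-differ = c₁≢c₂
    }
    where
    apex-path : rootPath z ≡ ys ∷ʳ z
    apex-path = sym (rootPath-unique
      (Path-prefix ys z (c₁ ∷ xs₁) (trans eq₁ (++-assoc ys [ z ] (c₁ ∷ xs₁))) (rootPath-path h₁)))
    child-parent : ∀ {h c xs} → rootPath h ≡ (ys ∷ʳ z) ++ c ∷ xs → Parent z c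
    child-parent {h} {c} {xs} eq =
      trans (sym (rootPath-unique (Path-prefix (ys ∷ʳ z) c xs eq (rootPath-path h))))
            (cong (_∷ʳ c) (sym apex-path))

  module PathSet (S : V → Set) (S-path : IsPathVertexSet adj S) where

    private
      P : List V
      P = proj₁ S-path

      P-linked : Linked adj P
      P-linked = proj₁ (proj₁ (proj₂ S-path))

      P-unique : Unique P
      P-unique = proj₁ (proj₂ (proj₁ (proj₂ S-path)))

      S⇒∈P : ∀ {x} → S x → x ∈ P
      S⇒∈P {x} = proj₁ (proj₂ (proj₂ S-path) x)

      ∈P⇒S : ∀ {x} → x ∈ P → S x
      ∈P⇒S {x} = proj₂ (proj₂ (proj₂ S-path) x)

      ∈-segment : ∀ {w} (xs : List V) c ys d zs → w ∈ c ∷ ys ∷ʳ d → w ∈ xs ++ c ∷ ys ++ d ∷ zs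
      ∈-segment {w} xs c ys d zs w∈ = ∈-++⁺ʳ xs (subst (w ∈_) (++-assoc (c ∷ ys) [ d ] zs) (∈-++⁺ˡ w∈))

    subpath : ∀ {x y} → S x → S y → ∃ λ xs → Path x xs y × (∀ {w} → w ∈ xs → S w)
    subpath {x} {y} sx sy with A , B , eqP ← ∈-∃++ (S⇒∈P sx) with ∈-++⁻ A (subst (y ∈_) eqP (S⇒∈P sy))
    ... | inj₂ (here refl) =
      [ x ] , vertex-path , λ { (here refl) → sx }
    ... | inj₂ (there y∈B) with B₁ , B₂ , refl ← ∈-∃++ y∈B =
      x ∷ B₁ ∷ʳ y , segment A x B₁ y B₂ eqP P-linked P-unique ,
      λ {w} w∈ → ∈P⇒S (subst (w ∈_) (sym eqP) (∈-segment A x B₁ y B₂ w∈))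
    ... | inj₁ y∈A with A₁ , A₂ , refl ← ∈-∃++ y∈A =
      reverse (y ∷ A₂ ∷ʳ x) , Path-reverse (segment A₁ y A₂ x B eqP′ P-linked P-unique) ,
      λ {w} w∈ → ∈P⇒S (subst (w ∈_) (sym eqP′) (∈-segment A₁ y A₂ x B (reverse⁻ {xs = y ∷ A₂ ∷ʳ x} w∈)))
      where
      eqP′ : P ≡ A₁ ++ y ∷ A₂ ++ x ∷ B
      eqP′ = trans eqP (++-assoc A₁ (y ∷ A₂) (x ∷ B))

    private
      shallowest : ∃ λ m → m ∈ P × (∀ {u} → u ∈ P → depth m ≤ depth u)
      shallowest = least depth P (proj₂ (proj₂ (proj₁ (proj₂ S-path))))

    minimum : V
    minimum = proj₁ shallowest

    S-minimum : S minimum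
    S-minimum = ∈P⇒S (proj₁ (proj₂ shallowest))

    minimum-extends : ∀ {u} → S u → ∃ λ ys → rootPath u ≡ rootPath minimum ++ ys × (∀ {w} → w ∈ ys → S w)
    minimum-extends su with xs , Q , Q⊆S ← subpath S-minimum su with ys , refl ← Path-starts Q =
      ys , sym (rootPath-unique (Path-join (rootPath-path minimum) Q disjoint)) , Q⊆S ∘ there
      where
      disjoint : Disjoint (rootPath minimum) ys
      disjoint {z} (z⊑m , z∈ys) with z ≟ minimum
      ... | yes refl = Unique[x∷xs]⇒x∉xs (unique Q) z∈ys
      ... | no z≢m   = n≮n (depth z) (<-≤-trans (depth-< z⊑m z≢m)
                                                (proj₂ (proj₂ shallowest) (S⇒∈P (Q⊆S (there z∈ys)))))

    minimum-⊑ : ∀ {u} → S u → minimum ⊑ u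
    minimum-⊑ su with ys , eq , _ ← minimum-extends su = subst (_ ∈_) (sym eq) (∈-++⁺ˡ ⊑-refl)

    convex : ∀ {u a} → S u → minimum ⊑ a → a ⊑ u → S a
    convex su m⊑a a⊑u with ys , eq , ys⊆S ← minimum-extends su
      with ∈-++⁻ (rootPath minimum) (subst (_ ∈_) eq a⊑u)
    ... | inj₁ a⊑m  = subst S (⊑-antisym m⊑a a⊑m) S-minimum
    ... | inj₂ a∈ys = ys⊆S a∈ys

    crossing-edge : ∀ {a b u w} → Parent a b → S u → b ⊑ u → S w → ¬ b ⊑ w → S a × S b
    crossing-edge {a} {b} ab su b⊑u sw b⋢w with ⊑-comparable b⊑u (minimum-⊑ su)
    ... | inj₁ b⊑m = ⊥-elim (b⋢w (⊑-trans b⊑m (minimum-⊑ sw)))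
    ... | inj₂ m⊑b with minimum ≟ b
    ...   | yes refl = ⊥-elim (b⋢w (minimum-⊑ sw))
    ...   | no m≢b   = convex su (⊑-parent ab m⊑b m≢b) (⊑-trans (Parent⇒⊑ ab) b⊑u) , convex su m⊑b b⊑u

    private
      neighbour-position : ∀ {x t} A B → P ≡ A ++ x ∷ B → S t → adj x t →
                           (∃ λ A′ → A ≡ A′ ∷ʳ t) ⊎ (∃ λ B′ → B ≡ t ∷ B′)
      neighbour-position {x} {t} A B eqP st xt with ∈-++⁻ A (subst (t ∈_) eqP (S⇒∈P st))
      ... | inj₂ (here refl) = ⊥-elim (adj-irrefl xt)
      ... | inj₂ (there t∈B) with B₁ , B₂ , refl ← ∈-∃++ t∈B
          with refl ← ∷ʳ-injectiveˡ B₁ [] (∷-injectiveʳ (path-unique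
                        (segment A x B₁ t B₂ eqP P-linked P-unique) (edge-path xt)))
          = inj₂ (B₂ , refl)
      ... | inj₁ t∈A with A₁ , A₂ , refl ← ∈-∃++ t∈A
          with refl ← ∷ʳ-injectiveˡ A₂ [] (∷-injectiveʳ (path-unique
                        (segment A₁ t A₂ x B (trans eqP (++-assoc A₁ (t ∷ A₂) (x ∷ B))) P-linked P-unique)
                        (edge-path (adj-sym xt))))
          = inj₁ (A₁ , refl)

    no-three-neighbours : ∀ {x t₁ t₂ t₃} → S x → S t₁ → S t₂ → S t₃ → adj x t₁ → adj x t₂ → adj x t₃ →
                          t₁ ≢ t₂ → t₁ ≢ t₃ → t₂ ≢ t₃ → ⊥
    no-three-neighbours sx s₁ s₂ s₃ x₁ x₂ x₃ t₁≢t₂ t₁≢t₃ t₂≢t₃ with A , B , eqP ← ∈-∃++ (S⇒∈P sx)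
      with neighbour-position A B eqP s₁ x₁ | neighbour-position A B eqP s₂ x₂ | neighbour-position A B eqP s₃ x₃
    ... | inj₁ (A₁ , e₁) | inj₁ (A₂ , e₂) | _              = t₁≢t₂ (∷ʳ-injectiveʳ A₁ A₂ (trans (sym e₁) e₂))
    ... | inj₁ (A₁ , e₁) | _              | inj₁ (A₃ , e₃) = t₁≢t₃ (∷ʳ-injectiveʳ A₁ A₃ (trans (sym e₁) e₃))
    ... | _              | inj₁ (A₂ , e₂) | inj₁ (A₃ , e₃) = t₂≢t₃ (∷ʳ-injectiveʳ A₂ A₃ (trans (sym e₂) e₃))
    ... | inj₂ (B₁ , e₁) | inj₂ (B₂ , e₂) | _              = t₁≢t₂ (∷-injectiveˡ (trans (sym e₁) e₂))
    ... | inj₂ (B₁ , e₁) | _              | inj₂ (B₃ , e₃) = t₁≢t₃ (∷-injectiveˡ (trans (sym e₁) e₃))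
    ... | _              | inj₂ (B₂ , e₂) | inj₂ (B₃ , e₃) = t₂≢t₃ (∷-injectiveˡ (trans (sym e₂) e₃))

    -- Otherwise the apex z would be strictly below the minimum and S would contain
    -- z together with its parent and both children.
    fork-⊑-minimum : ∀ {z c₁ c₂ y₁ y₂} → Parent z c₁ → Parent z c₂ → c₁ ≢ c₂ →
                     S y₁ → S y₂ → c₁ ⊑ y₁ → c₂ ⊑ y₂ → z ⊑ minimum
    fork-⊑-minimum {z} {c₁} {c₂} {y₁} zc₁ zc₂ c₁≢c₂ s₁ s₂ c₁⊑y₁ c₂⊑y₂
      with ⊑-comparable (⊑-trans (Parent⇒⊑ zc₁) c₁⊑y₁) (minimum-⊑ s₁)
    ... | inj₁ z⊑m = z⊑m
    ... | inj₂ m⊑z with minimum ≟ z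
    ...   | yes refl = ⊑-refl
    ...   | no m≢z with p , pz ← parent (⊑-≢⇒nonroot m⊑z m≢z) =
      ⊥-elim (no-three-neighbours sz sp sc₁ sc₂ (adj-sym (Parent⇒adj pz)) (Parent⇒adj zc₁) (Parent⇒adj zc₂)
                (grandparent-≢ pz zc₁) (grandparent-≢ pz zc₂) c₁≢c₂)
      where
      z⊑y₁ : z ⊑ y₁
      z⊑y₁ = ⊑-trans (Parent⇒⊑ zc₁) c₁⊑y₁
      sz : S z
      sz = convex s₁ m⊑z z⊑y₁
      sp : S p
      sp = convex s₁ (⊑-parent pz m⊑z m≢z) (⊑-trans (Parent⇒⊑ pz) z⊑y₁)
      sc₁ : S c₁
      sc₁ = convex s₁ (⊑-trans m⊑z (Parent⇒⊑ zc₁)) c₁⊑y₁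
      sc₂ : S c₂
      sc₂ = convex s₂ (⊑-trans m⊑z (Parent⇒⊑ zc₂)) c₂⊑y₂

module Bipartite {W Y : Set} (_≟W_ : DecidableEquality W) (adjW : W → W → Set) (treeW : IsTree adjW) (rootW : W)
                 (_≟Y_ : DecidableEquality Y) (adjY : Y → Y → Set) (treeY : IsTree adjY) (rootY : Y)
                 (R : W → Y → Set)
                 (ΓW-path : ∀ w → IsPathVertexSet adjY (R w))
                 (ΓY-path : ∀ y → IsPathVertexSet adjW (λ w → R w y)) where

  module TW = RootedTree _≟W_ adjW treeW rootW
  module TY = RootedTree _≟Y_ adjY treeY rootY
  module ΓW (w : W) = TY.PathSet (R w) (ΓW-path w)
  module ΓY (y : Y) = TW.PathSet (λ w → R w y) (ΓY-path y)

  -- The subtrees below the edges a b and q x would be cut off from the rest of the graph.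
  Separating : W → W → Y → Y → Set
  Separating a b q x = TW.Parent a b × TY.Parent q x ×
                       (∀ {y} → R a y → R b y → x TY.⊑ y) × (∀ {w} → R w q → R w x → b TW.⊑ w)

  -- Otherwise μ(w) lies strictly above μ(a), and the edge from a towards w together with the
  -- edge into μ(a) would be separating.
  minimum-monotone : (∀ {a b q x} → ¬ Separating a b q x) →
                     ∀ {a w c} → a TW.⊑ w → a ≢ w → R a c → R w c → ΓW.minimum a TY.⊑ ΓW.minimum w
  minimum-monotone no-separation {a} {w} {c} a⊑w a≢w rac rwc
    with TY.⊑-comparable (ΓW.minimum-⊑ a rac) (ΓW.minimum-⊑ w rwc)
  ... | inj₁ μa⊑μw = μa⊑μw
  ... | inj₂ μw⊑μa with ΓW.minimum w ≟Y ΓW.minimum a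
  ...   | yes μw≡μa = subst (ΓW.minimum a TY.⊑_) (sym μw≡μa) TY.⊑-refl
  ...   | no μw≢μa
    with q , qμa ← TY.parent (TY.⊑-≢⇒nonroot μw⊑μa μw≢μa)
    with b , ab , b⊑w ← TW.child-toward a⊑w a≢w
    = ⊥-elim (no-separation (ab , qμa , (λ ray _ → ΓW.minimum-⊑ a ray) , below-b))
    where
    rwq : R w q
    rwq = ΓW.convex w rwc (TY.⊑-parent qμa μw⊑μa μw≢μa) (TY.⊑-trans (TY.Parent⇒⊑ qμa) (ΓW.minimum-⊑ a rac))
    below-b : ∀ {u} → R u q → R u (ΓW.minimum a) → b TW.⊑ u
    below-b {u} ruq _ with b TW.⊑? u
    ... | yes b⊑u = b⊑u
    ... | no b⋢u  = ⊥-elim (TY.Parent⇒≢ qμa (TY.⊑-antisym (TY.Parent⇒⊑ qμa)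
                      (ΓW.minimum-⊑ a (proj₁ (ΓY.crossing-edge q ab rwq b⊑w ruq b⋢u)))))

  _<b_ : W → W → Set
  _<b_ = LtB (RootLt adjW rootW) (RootLe adjY rootY) (RootLt adjY rootY) R

  minimum-minimal : ∀ w → IsMinimal (RootLe adjY rootY) (R w) (ΓW.minimum w)
  minimum-minimal w = ΓW.S-minimum w , λ y rwy y≤μ → TY.⊑-antisym (TY.RootLe⇒⊑ y≤μ) (ΓW.minimum-⊑ w rwy)

  <b-of-minimum : ∀ {w w′} → ΓW.minimum w TY.⊑ ΓW.minimum w′ → ΓW.minimum w ≢ ΓW.minimum w′ → w <b w′
  <b-of-minimum μ⊑μ′ μ≢μ′ = _ , _ , minimum-minimal _ , minimum-minimal _ , inj₁ (TY.⊑⇒RootLe μ⊑μ′ , μ≢μ′)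

  <b-of-ancestor : (∀ {a b q x} → ¬ Separating a b q x) →
                   ∀ {w w′ y} → w TW.⊑ w′ → w ≢ w′ → R w y → R w′ y → w <b w′
  <b-of-ancestor no-separation {w} {w′} w⊑w′ w≢w′ rwy rw′y with ΓW.minimum w ≟Y ΓW.minimum w′
  ... | yes μ≡μ′ = _ , _ , minimum-minimal _ , minimum-minimal _ , inj₂ (μ≡μ′ , TW.⊑⇒RootLe w⊑w′ , w≢w′)
  ... | no μ≢μ′  = <b-of-minimum (minimum-monotone no-separation w⊑w′ w≢w′ rwy rw′y) μ≢μ′

  minima-ordered : ∀ {w₁ w₂ y} → ¬ w₂ <b w₁ → R w₁ y → R w₂ y → ΓW.minimum w₁ TY.⊑ ΓW.minimum w₂
  minima-ordered {w₁} {w₂} w₂≮w₁ r₁ r₂ with TY.⊑-comparable (ΓW.minimum-⊑ w₁ r₁) (ΓW.minimum-⊑ w₂ r₂)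
  ... | inj₁ μ₁⊑μ₂ = μ₁⊑μ₂
  ... | inj₂ μ₂⊑μ₁ with ΓW.minimum w₂ ≟Y ΓW.minimum w₁
  ...   | yes μ₂≡μ₁ = subst (ΓW.minimum w₁ TY.⊑_) (sym μ₂≡μ₁) TY.⊑-refl
  ...   | no μ₂≢μ₁  = ⊥-elim (w₂≮w₁ (<b-of-minimum μ₂⊑μ₁ μ₂≢μ₁))

  adjacent-to-ancestor : ∀ {w₁ w₂ y₁ y₂} → ¬ w₂ <b w₁ → R w₁ y₂ → R w₂ y₂ → R w₂ y₁ → y₁ TY.⊑ y₂ → R w₁ y₁
  adjacent-to-ancestor {w₁} {w₂} w₂≮w₁ r₁₂ r₂₂ r₂₁ y₁⊑y₂ =
    ΓW.convex w₁ r₁₂ (TY.⊑-trans (minima-ordered w₂≮w₁ r₁₂ r₂₂) (ΓW.minimum-⊑ w₂ r₂₁)) y₁⊑y₂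

  fork-apex-adjacent : ∀ {w₁ w₂ y₁ y₂} → ¬ w₂ <b w₁ → R w₁ y₂ → R w₂ y₂ → R w₂ y₁ →
                       (F : TY.Fork y₁ y₂) → R w₁ (TY.Fork.apex F) × R w₂ (TY.Fork.apex F)
  fork-apex-adjacent {w₁} {w₂} w₂≮w₁ r₁₂ r₂₂ r₂₁ F =
    ΓW.convex w₁ r₁₂ (TY.⊑-trans (minima-ordered w₂≮w₁ r₁₂ r₂₂) μ₂⊑apex) apex⊑₂ ,
    ΓW.convex w₂ r₂₂ μ₂⊑apex apex⊑₂
    where
    open TY.Fork F
    μ₂⊑apex : ΓW.minimum w₂ TY.⊑ apex
    μ₂⊑apex = common-⊑-apex (ΓW.minimum-⊑ w₂ r₂₁) (ΓW.minimum-⊑ w₂ r₂₂)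

  fork-covers : ∀ {w₁ w₂ y} (F : TW.Fork w₁ w₂) → R w₁ y → R w₂ y → ∀ {w} → R w y → TW.Fork.apex F TW.⊑ w
  fork-covers {y = y} F r₁ r₂ rw = TW.⊑-trans
    (ΓY.fork-⊑-minimum y parent₁ parent₂ children-differ r₁ r₂ child₁⊑ child₂⊑) (ΓY.minimum-⊑ y rw)
    where open TW.Fork F

module Graph {m n : ℕ} (G : TreePathIntersectionGraph m n) (hroot : Fin m) (vroot : Fin n)
             (E-root : TreePathIntersectionGraph.E G hroot vroot) where

  open TreePathIntersectionGraph G
  open Rooted G hroot vroot

  module H = RootedTree _≟_ TH TH-tree hroot
  module V = RootedTree _≟_ TV TV-tree vroot
  module HV = Bipartite _≟_ TH TH-tree hroot _≟_ TV TV-tree vroot E ΓH-path ΓV-path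
  module VH = Bipartite _≟_ TV TV-tree vroot _≟_ TH TH-tree hroot (λ v h → E h v) ΓV-path ΓH-path
  open HV using () renaming (module ΓW to ΓH; module ΓY to ΓV)

  -- The vertices outside both subtrees and without neighbours in them are closed under
  -- adjacency and include h_root, but not x.
  no-separating-edges : ∀ {a b q x} → ¬ VH.Separating a b q x
  no-separating-edges {a} {b} {q} {x} (ab , qx , common-ab , common-qx)
    with _ ∷ path , ((path-linked , _) , refl , path-end) ← connected (inj₁ hroot) (inj₁ x)
    = proj₁ (Linked-propagate {P = Outside} step path-linked path-end outside-root) H.⊑-refl
    where
    Outside : Fin m ⊎ Fin n → Set
    Outside (inj₁ h) = ¬ x H.⊑ h × (∀ {v} → E h v → ¬ b V.⊑ v)
    Outside (inj₂ v) = ¬ b V.⊑ v × (∀ {h} → E h v → ¬ x H.⊑ h)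

    step : ∀ {s t} → BipAdj E s t → Outside s → Outside t
    step {inj₁ h} {inj₂ v} hv (x⋢h , h-out) = h-out hv , λ h′v x⊑h′ →
      h-out hv (uncurry common-qx (ΓV.crossing-edge v qx h′v x⊑h′ hv x⋢h))
    step {inj₂ v} {inj₁ h} hv (b⋢v , v-out) = v-out hv , λ hv′ b⊑v′ →
      v-out hv (uncurry common-ab (ΓH.crossing-edge h ab hv′ b⊑v′ hv b⋢v))

    x⋢hroot : ¬ x H.⊑ hroot
    x⋢hroot = H.Parent⇒nonroot qx ∘ H.⊑-root

    outside-root : Outside (inj₁ hroot)
    outside-root = x⋢hroot , λ hv b⊑v →
      x⋢hroot (uncurry common-ab (ΓH.crossing-edge hroot ab hv b⊑v E-root (V.Parent⇒nonroot ab ∘ V.⊑-root)))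

  no-separating-edgesᴴ : ∀ {a b q x} → ¬ HV.Separating a b q x
  no-separating-edgesᴴ (ab , qx , common-ab , common-qx) = no-separating-edges (qx , ab , common-qx , common-ab)

  no-mutual-cover : ∀ {z w} → w ≢ vroot → (∀ {h} → E h w → z H.⊑ h) → (∀ {v} → E z v → w V.⊑ v) → ⊥
  no-mutual-cover {z} w≢vroot zw wz with z ≟ hroot
  ... | yes refl = w≢vroot (V.⊑-root (wz E-root))
  ... | no z≢hroot with _ , pz ← H.parent z≢hroot | _ , pw ← V.parent w≢vroot =
    no-separating-edges (pw , pz , (λ _ hw → zw hw) , (λ _ zv → wz zv))

  crossed-forks : IsLeaf TV vroot → ∀ {h₁ h₂ v₁ v₂} → ¬ h₂ <bH h₁ → ¬ v₂ <bV v₁ →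
                  H.Fork h₁ h₂ → V.Fork v₁ v₂ → E h₁ v₂ → E h₂ v₂ → E h₂ v₁ → ⊥
  crossed-forks leaf {h₁} {h₂} {v₁} {v₂} h₂≮h₁ v₂≮v₁ Fh Fv e₁₂ e₂₂ e₂₁ =
    no-mutual-cover w≢vroot (HV.fork-covers Fh (proj₁ hw) (proj₂ hw)) (VH.fork-covers Fv (proj₁ zv) (proj₂ zv))
    where
    z : Fin m
    z = H.Fork.apex Fh
    w : Fin n
    w = V.Fork.apex Fv
    hw : E h₁ w × E h₂ w
    hw = HV.fork-apex-adjacent h₂≮h₁ e₁₂ e₂₂ e₂₁ Fv
    zv : E z v₁ × E z v₂
    zv = VH.fork-apex-adjacent v₂≮v₁ e₂₁ e₂₂ e₁₂ Fh
    w≢vroot : w ≢ vroot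
    w≢vroot w≡vroot = V.Fork.apex-not-leaf Fv (subst (IsLeaf TV) (sym w≡vroot) leaf)

  neighbourhoods-interval : IsLeaf TV vroot → ∀ {h₁ h₂ v₁ v₂} → ¬ h₂ <bH h₁ → ¬ v₂ <bV v₁ →
                            E h₁ v₂ → E h₂ v₂ → E h₂ v₁ → E h₁ v₁
  neighbourhoods-interval leaf {h₁} {h₂} {v₁} {v₂} h₂≮h₁ v₂≮v₁ e₁₂ e₂₂ e₂₁ with h₁ ≟ h₂ | v₁ ≟ v₂
  ... | yes refl | _        = e₂₁
  ... | no _     | yes refl = e₁₂
  ... | no h₁≢h₂ | no v₁≢v₂ with h₁ H.⊑? h₂ | v₁ V.⊑? v₂
  ...   | yes h₁⊑h₂ | _         = VH.adjacent-to-ancestor v₂≮v₁ e₂₁ e₂₂ e₁₂ h₁⊑h₂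
  ...   | no _      | yes v₁⊑v₂ = HV.adjacent-to-ancestor h₂≮h₁ e₁₂ e₂₂ e₂₁ v₁⊑v₂
  ...   | no h₁⋢h₂  | no v₁⋢v₂ with h₂ H.⊑? h₁ | v₂ V.⊑? v₁
  ...     | yes h₂⊑h₁ | _ =
    ⊥-elim (h₂≮h₁ (HV.<b-of-ancestor no-separating-edgesᴴ h₂⊑h₁ (h₁≢h₂ ∘ sym) e₂₂ e₁₂))
  ...     | no _      | yes v₂⊑v₁ =
    ⊥-elim (v₂≮v₁ (VH.<b-of-ancestor no-separating-edges v₂⊑v₁ (v₁≢v₂ ∘ sym) e₂₂ e₂₁))
  ...     | no h₂⋢h₁  | no v₂⋢v₁ =
    ⊥-elim (crossed-forks leaf h₂≮h₁ v₂≮v₁ (H.fork h₁⋢h₂ h₂⋢h₁) (V.fork v₁⋢v₂ v₂⋢v₁) e₁₂ e₂₂ e₂₁)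

ReflClosure-asym : ∀ {A : Set} {L : A → A → Set} → IsStrictPartialOrder _≡_ L →
                   ∀ {a b} → ReflClosure L a b → ¬ L b a
ReflClosure-asym L-order (inj₁ refl) = IsStrictPartialOrder.irrefl L-order refl
ReflClosure-asym L-order (inj₂ a<b)  = IsStrictPartialOrder.asym L-order a<b

lemma17 : {m n : ℕ} (G : TreePathIntersectionGraph m n) (hroot : Fin m) (vroot : Fin n) →
    TreePathIntersectionGraph.E G hroot vroot →
    IsLeaf (TreePathIntersectionGraph.TV G) vroot →
    (LH : Fin m → Fin m → Set) (LV : Fin n → Fin n → Set) →
    Rooted.IsLinExtH G hroot vroot LH →
    Rooted.IsLinExtV G hroot vroot LV →
    (h₁ h₂ : Fin m) (v₁ v₂ : Fin n) →
    ReflClosure LH h₁ h₂ → ReflClosure LV v₁ v₂ →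
    TreePathIntersectionGraph.E G h₁ v₂ →
    TreePathIntersectionGraph.E G h₂ v₂ →
    TreePathIntersectionGraph.E G h₂ v₁ →
    TreePathIntersectionGraph.E G h₁ v₁
lemma17 G hroot vroot E-root leaf LH LV (LH-order , LH-extends) (LV-order , LV-extends) h₁ h₂ v₁ v₂ h₁≤h₂ v₁≤v₂ =
  Graph.neighbourhoods-interval G hroot vroot E-root leaf
    (ReflClosure-asym (IsStrictTotalOrder.isStrictPartialOrder LH-order) h₁≤h₂ ∘ LH-extends h₂ h₁)
    (ReflClosure-asym (IsStrictTotalOrder.isStrictPartialOrder LV-order) v₁≤v₂ ∘ LV-extends v₂ v₁)
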